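{- Let $\gamma \geq 2$ and $n \geq 3\gamma$ be integers. Let $\mathcal{B}_{n,\gamma}$ denote the set of all bipartite graphs without isolated vertices that have order $n$, domination number $\gamma$, and exactly one minimum dominating set. Then there exists a perfectly dominated $G \in \mathcal{B}_{n,\gamma}$ whose number of edges equals $$2 \gamma + 2 \Big\lceil \frac{\gamma}{2} \Big\rceil \Big\lfloor \frac{\gamma}{2} \Big\rfloor + \min\Big\{n-3\gamma,\ 2 \Big\lceil \frac{\gamma}{2} \Big\rceil - \Big\lfloor \frac{\gamma}{2}\Big\rfloor+ 1\Big\}\Big(2\Big\lceil\frac{\gamma}{2}\Big\rceil + 1\Big) + \sum_{i=1}^{\Phi} \Big(\Big(2\Big\lceil\frac{\gamma}{2}\Big\rceil+1\Big) + \Big\lceil\frac{i}{2}\Big\rceil\Big),$$ where $\Phi = \max\big(0,\ n-3\gamma - 2\lceil\frac{\gamma}{2}\rceil - \lfloor\frac{\gamma}{2}\rfloor + 1\big)$ (an empty sum is $0$).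
   Context: All graphs are finite and simple. A dominating set of a graph $G=(V,E)$ is a set $D\subseteq V$ such that every vertex of $V\setminus D$ is adjacent to some vertex of $D$; the domination number $\gamma(G)$ is the minimum size of a dominating set, and a minimum dominating set is one of size $\gamma(G)$. A graph $G$ without isolated vertices, of order $n$ and domination number $\gamma$, is perfectly dominated if it has a minimum dominating set $D$ with $\sum_{x\in D}\deg(x) = n-\gamma$ (equivalently, $D$ is independent and every vertex outside $D$ is adjacent to exactly one vertex of $D$). -}

module Defs where

open import Data.Nat using (ℕ; zero; suc; _+_; _*_; _∸_; _≤_; _<ᵇ_; ⌊_/2⌋; ⌈_/2⌉; _⊓_)
open import Data.Bool using (Bool; true; false; _∧_; if_then_else_)
open import Data.Fin using (Fin; toℕ)
open import Data.Fin.Subset using (Subset; _∈_; ∣_∣)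
open import Data.Vec using (lookup)
open import Data.List using (List; map; allFin; concatMap)
open import Data.Nat.ListAction using (sum)
open import Data.Product using (Σ; ∃; _×_; _,_)
open import Data.Sum using (_⊎_)
open import Relation.Nullary using (¬_)
open import Relation.Binary.PropositionalEquality using (_≡_; _≢_)

record Graph (n : ℕ) : Set where
  field
    adj   : Fin n → Fin n → Bool
    sym   : ∀ u v → adj u v ≡ adj v u
    irrefl : ∀ v → adj v v ≡ false
open Graph public

b2n : Bool → ℕ
b2n true = 1
b2n false = 0

deg : ∀ {n} → Graph n → Fin n → ℕ
deg {n} G x = sum (map (λ u → b2n (adj G x u)) (allFin n))

edgeCount : ∀ {n} → Graph n → ℕ
edgeCount {n} G =
  sum (concatMap (λ u → map (λ v → b2n ((toℕ u <ᵇ toℕ v) ∧ adj G u v)) (allFin n)) (allFin n))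

NoIsolated : ∀ {n} → Graph n → Set
NoIsolated {n} G = ∀ v → ∃ λ u → adj G v u ≡ true

Bipartite : ∀ {n} → Graph n → Set
Bipartite {n} G = Σ (Fin n → Bool) λ c → ∀ u v → adj G u v ≡ true → c u ≢ c v

Dominating : ∀ {n} → Graph n → Subset n → Set
Dominating {n} G D = ∀ v → v ∈ D ⊎ (∃ λ u → u ∈ D × adj G u v ≡ true)

DominationNumber : ∀ {n} → Graph n → ℕ → Set
DominationNumber {n} G g =
  (Σ (Subset n) λ D → Dominating G D × ∣ D ∣ ≡ g) × (∀ D → Dominating G D → g ≤ ∣ D ∣)

MinDominating : ∀ {n} → Graph n → ℕ → Subset n → Set
MinDominating G g D = Dominating G D × ∣ D ∣ ≡ g

UniqueMinDom : ∀ {n} → Graph n → ℕ → Set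
UniqueMinDom {n} G g =
  Σ (Subset n) λ D → MinDominating G g D × (∀ D' → MinDominating G g D' → D' ≡ D)

degSum : ∀ {n} → Graph n → Subset n → ℕ
degSum {n} G D = sum (map (λ x → if lookup D x then deg G x else 0) (allFin n))

PerfectlyDominated : ∀ {n} → Graph n → ℕ → Set
PerfectlyDominated {n} G g = Σ (Subset n) λ D → MinDominating G g D × degSum G D ≡ n ∸ g

InB : ∀ {n} → Graph n → ℕ → Set
InB G g = Bipartite G × NoIsolated G × DominationNumber G g × UniqueMinDom G g

sumTerm : ℕ → ℕ → ℕ
sumTerm a zero = 0
sumTerm a (suc k) = sumTerm a k + (a + ⌈ suc k /2⌉)

edgeFormula : ℕ → ℕ → ℕ
edgeFormula n g =
  let c = ⌈ g /2⌉ ; f = ⌊ g /2⌋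
      Φ = (n + 1) ∸ (3 * g + 2 * c + f)
  in 2 * g + 2 * c * f
     + ((n ∸ 3 * g) ⊓ ((2 * c + 1) ∸ f)) * (2 * c + 1)
     + sumTerm (2 * c + 1) Φ

{-# OPTIONS --safe #-}
-- The graph has a dominating set D = P ∪ Q, |P| = ⌈γ/2⌉, |Q| = ⌊γ/2⌋, such that every vertex outside D
-- has exactly one neighbour in D, its owner; so D is perfect. A dominating set meets each of the γ
-- classes {d} ∪ owner⁻¹(d), hence has at least γ vertices, and one of size γ meets each class once.
-- Every Q-vertex has a pendant leaf, so its class is met below the hubs, which keeps all Q-hubs out.
-- Every P-vertex owns two P-hubs whose other neighbours are Q-hubs, so it must be in; then no P-hub
-- is in, the Q-hubs force the Q-vertices in, and the set is D. The edge count is (n - γ) + XY - δ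
-- for X P-hubs, Y Q-hubs and δ removed hub edges; X, Y, δ are chosen to match the formula.
module Submission where

open import Defs hiding (sym)
open import Data.Nat
open import Data.Nat.Properties
open import Data.Nat.Tactic.RingSolver using (solve-∀)
open import Data.Nat.ListAction using (sum)
open import Data.Nat.ListAction.Properties using (sum-++)
open import Data.Bool using (Bool; true; false; _∧_; _∨_; not; T; if_then_else_)
open import Data.Bool.Properties using (∧-identityʳ; ∧-zeroʳ; ∨-comm; ∨-identityʳ; T-≡; T-∧; T-∨)
open import Data.Unit using (tt)
open import Data.Empty using (⊥-elim)
open import Data.Product using (Σ; ∃; _×_; _,_; proj₁; proj₂)
open import Data.Sum using (_⊎_; inj₁; inj₂; [_,_]′)
open import Data.Fin using (Fin; toℕ; fromℕ<)
open import Data.Fin.Properties using (toℕ<n; toℕ-fromℕ<)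
open import Data.Fin.Subset using (Subset; _∈_; ∣_∣)
open import Data.Vec using ([]; _∷_; lookup; tabulate)
open import Data.Vec.Properties using (lookup∘tabulate; tabulate∘lookup; tabulate-cong; []=⇒lookup; lookup⇒[]=)
open import Data.List using (List; map; allFin; concatMap)
import Data.List as List
open import Data.List.Properties using (map-tabulate; map-cong)
open import Function using (_∘_; Equivalence)
open import Relation.Nullary using (¬_; Dec; does; yes; no)
open import Relation.Nullary.Reflects using (ofʸ; ofⁿ)
open import Relation.Nullary.Decidable using (dec-true; dec-false; _×-dec_; T?)
open import Relation.Binary.PropositionalEquality

does⇒ : ∀ {A : Set} (a? : Dec A) → T (does a?) → A
does⇒ (yes a) _ = a

does⇐ : ∀ {A : Set} (a? : Dec A) → A → T (does a?)
does⇐ (yes _)  _ = tt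
does⇐ (no ¬a) a = ¬a a

-- Finite sums and counting

∑< : ℕ → (ℕ → ℕ) → ℕ
∑< zero    F = 0
∑< (suc n) F = ∑< n F + F n

syntax ∑< n (λ i → e) = ∑[ i < n ] e

∑-cong : ∀ {F G} n → (∀ i → i < n → F i ≡ G i) → ∑< n F ≡ ∑< n G
∑-cong zero    F≗G = refl
∑-cong (suc n) F≗G = cong₂ _+_ (∑-cong n (λ i i<n → F≗G i (m<n⇒m<1+n i<n))) (F≗G n ≤-refl)

∑-zero : ∀ {F} n → (∀ i → i < n → F i ≡ 0) → ∑< n F ≡ 0
∑-zero zero    F≗0 = refl
∑-zero (suc n) F≗0 = cong₂ _+_ (∑-zero n (λ i i<n → F≗0 i (m<n⇒m<1+n i<n))) (F≗0 n ≤-refl)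

∑-distrib-+ : ∀ F G n → ∑[ i < n ] (F i + G i) ≡ ∑< n F + ∑< n G
∑-distrib-+ F G zero    = refl
∑-distrib-+ F G (suc n) = trans (cong (_+ (F n + G n)) (∑-distrib-+ F G n)) (+-exchange (∑< n F) (∑< n G) (F n) (G n))
  where
  +-exchange : ∀ a b c d → a + b + (c + d) ≡ a + c + (b + d)
  +-exchange = solve-∀

∑-distribʳ-* : ∀ F k n → ∑[ i < n ] (F i * k) ≡ ∑< n F * k
∑-distribʳ-* F k zero    = refl
∑-distribʳ-* F k (suc n) = trans (cong (_+ F n * k) (∑-distribʳ-* F k n)) (sym (*-distribʳ-+ k (∑< n F) (F n)))

∑-distribˡ-* : ∀ F k n → ∑[ i < n ] (k * F i) ≡ k * ∑< n F
∑-distribˡ-* F k zero    = sym (*-zeroʳ k)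
∑-distribˡ-* F k (suc n) = trans (cong (_+ k * F n) (∑-distribˡ-* F k n)) (sym (*-distribˡ-+ k (∑< n F) (F n)))

∑-comm : ∀ (F : ℕ → ℕ → ℕ) m n → ∑[ i < m ] ∑[ j < n ] F i j ≡ ∑[ j < n ] ∑[ i < m ] F i j
∑-comm F zero    n = sym (∑-zero n (λ _ _ → refl))
∑-comm F (suc m) n = begin
  ∑[ i < m ] ∑[ j < n ] F i j + ∑[ j < n ] F m j  ≡⟨ cong (_+ ∑[ j < n ] F m j) (∑-comm F m n) ⟩
  ∑[ j < n ] ∑[ i < m ] F i j + ∑[ j < n ] F m j  ≡⟨ ∑-distrib-+ (λ j → ∑[ i < m ] F i j) (λ j → F m j) n ⟨
  ∑[ j < n ] (∑[ i < m ] F i j + F m j)           ∎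
  where open ≡-Reasoning

∑₂-distrib-+ : ∀ (F G : ℕ → ℕ → ℕ) m n → ∑[ u < m ] ∑[ v < n ] (F u v + G u v)
                            ≡ ∑[ u < m ] ∑[ v < n ] F u v + ∑[ u < m ] ∑[ v < n ] G u v
∑₂-distrib-+ F G m n = trans (∑-cong m (λ u _ → ∑-distrib-+ (F u) (G u) n))
                             (∑-distrib-+ (λ u → ∑[ v < n ] F u v) (λ u → ∑[ v < n ] G u v) m)

∑-split : ∀ F a b → ∑< (a + b) F ≡ ∑< a F + ∑[ i < b ] F (a + i)
∑-split F a zero    = trans (cong (λ n → ∑< n F) (+-identityʳ a)) (sym (+-identityʳ _))
∑-split F a (suc b) = begin
  ∑< (a + suc b) F                                   ≡⟨ cong (λ n → ∑< n F) (+-suc a b) ⟩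
  ∑< (a + b) F + F (a + b)                           ≡⟨ cong (_+ F (a + b)) (∑-split F a b) ⟩
  ∑< a F + ∑[ i < b ] F (a + i) + F (a + b)          ≡⟨ +-assoc (∑< a F) _ _ ⟩
  ∑< a F + (∑[ i < b ] F (a + i) + F (a + b))        ∎
  where open ≡-Reasoning

term≤∑ : ∀ F n {i} → i < n → F i ≤ ∑< n F
term≤∑ F (suc n) i<1+n with m≤n⇒m<n∨m≡n (s≤s⁻¹ i<1+n)
... | inj₁ i<n  = ≤-trans (term≤∑ F n i<n) (m≤m+n _ _)
... | inj₂ refl = m≤n+m _ _

two-terms≤∑ : ∀ F n {i j} → i < n → j < n → i ≢ j → F i + F j ≤ ∑< n F
two-terms≤∑ F (suc n) {i} {j} i<1+n j<1+n i≢j with m≤n⇒m<n∨m≡n (s≤s⁻¹ i<1+n) | m≤n⇒m<n∨m≡n (s≤s⁻¹ j<1+n)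
... | inj₁ i<n  | inj₁ j<n  = ≤-trans (two-terms≤∑ F n i<n j<n i≢j) (m≤m+n _ _)
... | inj₁ i<n  | inj₂ refl = +-monoˡ-≤ (F j) (term≤∑ F n i<n)
... | inj₂ refl | inj₁ j<n  = subst (_≤ ∑< n F + F i) (+-comm (F j) (F i)) (+-monoˡ-≤ (F i) (term≤∑ F n j<n))
... | inj₂ refl | inj₂ refl = ⊥-elim (i≢j refl)

∑-≥-length : ∀ F n → (∀ i → i < n → 1 ≤ F i) → n ≤ ∑< n F
∑-≥-length F zero    _    = z≤n
∑-≥-length F (suc n) F≥1 = subst (_≤ ∑< n F + F n) (+-comm n 1)
  (+-mono-≤ (∑-≥-length F n (λ i i<n → F≥1 i (m<n⇒m<1+n i<n))) (F≥1 n ≤-refl))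

∑->-length : ∀ F n {j} → (∀ i → i < n → 1 ≤ F i) → j < n → 2 ≤ F j → n < ∑< n F
∑->-length F (suc n) {j} F≥1 j<1+n 2≤Fj with m≤n⇒m<n∨m≡n (s≤s⁻¹ j<1+n)
... | inj₁ j<n  = subst (_≤ ∑< n F + F n) (+-comm (suc n) 1)
  (+-mono-≤ (∑->-length F n (λ i i<n → F≥1 i (m<n⇒m<1+n i<n)) j<n 2≤Fj) (F≥1 n ≤-refl))
... | inj₂ refl = subst (_≤ ∑< n F + F j) (+-comm n 2)
  (+-mono-≤ (∑-≥-length F n (λ i i<n → F≥1 i (m<n⇒m<1+n i<n))) 2≤Fj)

∑-ones : ∀ n → ∑[ _ < n ] 1 ≡ n
∑-ones zero    = refl
∑-ones (suc n) = trans (cong (_+ 1) (∑-ones n)) (+-comm n 1)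

count-< : ∀ a N → a ≤ N → ∑[ v < N ] b2n (v <ᵇ a) ≡ a
count-< a N a≤N = begin
  ∑[ v < N ] b2n (v <ᵇ a)                                     ≡⟨ cong (λ n → ∑[ v < n ] b2n (v <ᵇ a)) (m+[n∸m]≡n a≤N) ⟨
  ∑[ v < a + (N ∸ a) ] b2n (v <ᵇ a)                           ≡⟨ ∑-split (λ v → b2n (v <ᵇ a)) a (N ∸ a) ⟩
  ∑[ v < a ] b2n (v <ᵇ a) + ∑[ i < N ∸ a ] b2n (a + i <ᵇ a)  ≡⟨ cong₂ _+_ (∑-cong a below) (∑-zero (N ∸ a) above) ⟩
  ∑[ _ < a ] 1 + 0                                            ≡⟨ trans (+-identityʳ _) (∑-ones a) ⟩
  a                                                           ∎
  where
  open ≡-Reasoning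
  below : ∀ v → v < a → b2n (v <ᵇ a) ≡ 1
  below v v<a = cong b2n (dec-true (v <? a) v<a)
  above : ∀ i → i < N ∸ a → b2n (a + i <ᵇ a) ≡ 0
  above i _ = cong b2n (dec-false (a + i <? a) (m+n≮m a i))

+-<ᵇ : ∀ a i t → (a + i <ᵇ a + t) ≡ (i <ᵇ t)
+-<ᵇ zero    i t = refl
+-<ᵇ (suc a) i t = +-<ᵇ a i t

count-range : ∀ a b N → a ≤ b → b ≤ N → ∑[ v < N ] b2n ((a ≤ᵇ v) ∧ (v <ᵇ b)) ≡ b ∸ a
count-range a b N a≤b b≤N = begin
  ∑[ v < N ] R v                                       ≡⟨ cong (λ n → ∑< n R) (m+[n∸m]≡n (≤-trans a≤b b≤N)) ⟨
  ∑[ v < a + (N ∸ a) ] R v                             ≡⟨ ∑-split R a (N ∸ a) ⟩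
  ∑[ v < a ] R v + ∑[ i < N ∸ a ] R (a + i)            ≡⟨ cong₂ _+_ (∑-zero a below) (∑-cong (N ∸ a) shifted) ⟩
  0 + ∑[ i < N ∸ a ] b2n (i <ᵇ b ∸ a)                  ≡⟨ count-< (b ∸ a) (N ∸ a) (∸-monoˡ-≤ a b≤N) ⟩
  b ∸ a                                                ∎
  where
  open ≡-Reasoning
  R : ℕ → ℕ
  R v = b2n ((a ≤ᵇ v) ∧ (v <ᵇ b))
  below : ∀ v → v < a → R v ≡ 0
  below v v<a = cong (λ x → b2n (x ∧ (v <ᵇ b))) (dec-false (a ≤? v) (<⇒≱ v<a))
  shifted : ∀ i → i < N ∸ a → R (a + i) ≡ b2n (i <ᵇ b ∸ a)
  shifted i _ = cong₂ (λ x y → b2n (x ∧ y)) (dec-true (a ≤? a + i) (m≤m+n a i))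
                      (trans (cong (a + i <ᵇ_) (sym (m+[n∸m]≡n a≤b))) (+-<ᵇ a i (b ∸ a)))

count-≡ : ∀ r N → r < N → ∑[ v < N ] b2n (r ≡ᵇ v) ≡ 1
count-≡ r (suc N) r<1+N with m≤n⇒m<n∨m≡n (s≤s⁻¹ r<1+N)
... | inj₁ r<N  = cong₂ _+_ (count-≡ r N r<N) (cong b2n (dec-false (r ≟ N) (<⇒≢ r<N)))
... | inj₂ refl = cong₂ _+_ (∑-zero r (λ v v<r → cong b2n (dec-false (r ≟ v) (≢-sym (<⇒≢ v<r)))))
                           (cong b2n (dec-true (r ≟ r) refl))

∑-indicator : ∀ b r N → (T b → r < N) → ∑[ d < N ] b2n (b ∧ (r ≡ᵇ d)) ≡ b2n b
∑-indicator true  r N r<N = count-≡ r N (r<N _)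
∑-indicator false r N _   = ∑-zero N (λ _ _ → refl)

count-≥ : ∀ a N → a ≤ N → ∑[ v < N ] b2n (a ≤ᵇ v) ≡ N ∸ a
count-≥ a N a≤N = trans (∑-cong N within) (count-range a N N a≤N ≤-refl)
  where
  within : ∀ v → v < N → b2n (a ≤ᵇ v) ≡ b2n ((a ≤ᵇ v) ∧ (v <ᵇ N))
  within v v<N = cong b2n (trans (sym (∧-identityʳ (a ≤ᵇ v))) (cong ((a ≤ᵇ v) ∧_) (sym (dec-true (v <? N) v<N))))

b2n-∧ : ∀ x y → b2n (x ∧ y) ≡ b2n x * b2n y
b2n-∧ true  y = sym (+-identityʳ (b2n y))
b2n-∧ false y = refl

∑-product : ∀ F G m n → ∑[ u < m ] ∑[ v < n ] (F u * G v) ≡ ∑< m F * ∑< n G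
∑-product F G m n = trans (∑-cong m (λ u _ → ∑-distribˡ-* G (F u) n)) (∑-distribʳ-* F (∑< n G) m)

count-pairs : ∀ (P Q : ℕ → Bool) m n →
              ∑[ u < m ] ∑[ v < n ] b2n (P u ∧ Q v) ≡ ∑[ u < m ] b2n (P u) * ∑[ v < n ] b2n (Q v)
count-pairs P Q m n = trans (∑-cong m (λ u _ → ∑-cong n (λ v _ → b2n-∧ (P u) (Q v)))) (∑-product (b2n ∘ P) (b2n ∘ Q) m n)


b2n-∨-disjoint : ∀ {x y} → (T x → ¬ T y) → b2n (x ∨ y) ≡ b2n x + b2n y
b2n-∨-disjoint {true}  {true}  disjoint = ⊥-elim (disjoint tt tt)
b2n-∨-disjoint {true}  {false} _        = refl
b2n-∨-disjoint {false} {y}     _        = refl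

b2n-∧-not : ∀ {x y} → (T y → T x) → b2n (x ∧ not y) + b2n y ≡ b2n x
b2n-∧-not {true}  {true}  _   = refl
b2n-∧-not {true}  {false} _   = refl
b2n-∧-not {false} {true}  y⇒x = ⊥-elim (y⇒x tt)
b2n-∧-not {false} {false} _   = refl

module Pigeonhole {N g : ℕ} (s : ℕ → Bool) (rep : ℕ → ℕ) (rep<g : ∀ v → v < N → rep v < g)
                  (covers : ∀ d → d < g → ∃ λ v → v < N × T (s v) × rep v ≡ d) where

  private
    fibre : ℕ → ℕ
    fibre d = ∑[ v < N ] b2n (s v ∧ (rep v ≡ᵇ d))

    in-fibre : ∀ {v d} → T (s v) → rep v ≡ d → b2n (s v ∧ (rep v ≡ᵇ d)) ≡ 1
    in-fibre {v} sv refl with s v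
    ... | true = cong b2n (dec-true (rep v ≟ rep v) refl)

    ∑s≡∑fibre : ∑[ v < N ] b2n (s v) ≡ ∑[ d < g ] fibre d
    ∑s≡∑fibre = trans (∑-cong N (λ v v<N → sym (∑-indicator (s v) (rep v) g (λ _ → rep<g v v<N))))
                      (∑-comm (λ v d → b2n (s v ∧ (rep v ≡ᵇ d))) N g)

    fibre≥1 : ∀ d → d < g → 1 ≤ fibre d
    fibre≥1 d d<g with covers d d<g
    ... | v , v<N , sv , rv≡d = subst (_≤ fibre d) (in-fibre sv rv≡d) (term≤∑ _ N v<N)

  g≤∣s∣ : g ≤ ∑[ v < N ] b2n (s v)
  g≤∣s∣ = subst (g ≤_) (sym ∑s≡∑fibre) (∑-≥-length fibre g fibre≥1)

  tight⇒rep-injective : ∑[ v < N ] b2n (s v) ≡ g → ∀ {x y} → x < N → y < N →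
                        T (s x) → T (s y) → rep x ≡ rep y → x ≡ y
  tight⇒rep-injective tight {x} {y} x<N y<N sx sy rx≡ry with x ≟ y
  ... | yes x≡y = x≡y
  ... | no  x≢y = ⊥-elim (<-irrefl (trans (sym tight) ∑s≡∑fibre) (∑->-length fibre g fibre≥1 (rep<g x x<N) fibre≥2))
    where
    fibre≥2 : 2 ≤ fibre (rep x)
    fibre≥2 = subst (_≤ fibre (rep x)) (cong₂ _+_ (in-fibre sx refl) (in-fibre sy (sym rx≡ry)))
                    (two-terms≤∑ _ N x<N y<N x≢y)

-- Graphs and subsets on numbered vertices

sum-tabulate : ∀ n (F : ℕ → ℕ) → sum (List.tabulate {n = n} (F ∘ toℕ)) ≡ ∑< n F
sum-tabulate zero    F = refl
sum-tabulate (suc n) F = trans (cong (F 0 +_) (sum-tabulate n (F ∘ suc))) (sym (∑-split F 1 n))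

sum-allFin : ∀ n (F : ℕ → ℕ) → sum (map (F ∘ toℕ) (allFin n)) ≡ ∑< n F
sum-allFin n F = trans (cong sum (map-tabulate {n = n} (λ x → x) (F ∘ toℕ))) (sum-tabulate n F)

sum-concatMap : ∀ {A : Set} (h : A → List ℕ) xs → sum (concatMap h xs) ≡ sum (map (sum ∘ h) xs)
sum-concatMap h List.[]         = refl
sum-concatMap h (x List.∷ xs) = trans (sum-++ (h x) (concatMap h xs)) (cong (sum (h x) +_) (sum-concatMap h xs))

χ : ∀ {n} → Subset n → ℕ → Bool
χ []      _       = false
χ (b ∷ S) zero    = b
χ (b ∷ S) (suc v) = χ S v

χ-lookup : ∀ {n} (S : Subset n) (x : Fin n) → χ S (toℕ x) ≡ lookup S x
χ-lookup (b ∷ S) Fin.zero    = refl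
χ-lookup (b ∷ S) (Fin.suc x) = χ-lookup S x

∈⇒χ : ∀ {n} {S : Subset n} {x} → x ∈ S → T (χ S (toℕ x))
∈⇒χ {S = S} {x} x∈S = Equivalence.from T-≡ (trans (χ-lookup S x) ([]=⇒lookup x∈S))

χ⇒∈ : ∀ {n} {S : Subset n} {x} → T (χ S (toℕ x)) → x ∈ S
χ⇒∈ {S = S} {x} χSx = lookup⇒[]= x S (trans (sym (χ-lookup S x)) (Equivalence.to T-≡ χSx))

∣∣≡∑χ : ∀ {n} (S : Subset n) → ∣ S ∣ ≡ ∑[ v < n ] b2n (χ S v)
∣∣≡∑χ []                  = refl
∣∣≡∑χ {suc n} (true ∷ S)  = trans (cong suc (∣∣≡∑χ S)) (sym (∑-split (λ v → b2n (χ (true ∷ S) v)) 1 n))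
∣∣≡∑χ {suc n} (false ∷ S) = trans (∣∣≡∑χ S) (sym (∑-split (λ v → b2n (χ (false ∷ S) v)) 1 n))

subsetᴺ : ∀ n → (ℕ → Bool) → Subset n
subsetᴺ n P = tabulate (P ∘ toℕ)

χ-subsetᴺ : ∀ {n} (P : ℕ → Bool) {v} → v < n → χ (subsetᴺ n P) v ≡ P v
χ-subsetᴺ {suc n} P {zero}  _         = refl
χ-subsetᴺ {suc n} P {suc v} (s≤s v<n) = χ-subsetᴺ (P ∘ suc) v<n

subsetᴺ-unique : ∀ {n} (S : Subset n) (P : ℕ → Bool) → (∀ v → v < n → χ S v ≡ P v) → S ≡ subsetᴺ n P
subsetᴺ-unique S P χS≗P = trans (sym (tabulate∘lookup S))
  (tabulate-cong (λ x → trans (sym (χ-lookup S x)) (χS≗P (toℕ x) (toℕ<n x))))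

∣subsetᴺ∣ : ∀ n (P : ℕ → Bool) → ∣ subsetᴺ n P ∣ ≡ ∑[ v < n ] b2n (P v)
∣subsetᴺ∣ n P = trans (∣∣≡∑χ (subsetᴺ n P)) (∑-cong n (λ v v<n → cong b2n (χ-subsetᴺ P v<n)))

-- A graph on Fin n presented by its edges u → v with u < v, read on vertex numbers.
module OrientedGraph (n : ℕ) (E : ℕ → ℕ → Bool) (E⇒< : ∀ {u v} → T (E u v) → u < v) where

  Adj : ℕ → ℕ → Bool
  Adj u v = E u v ∨ E v u

  E-irrefl : ∀ v → E v v ≡ false
  E-irrefl v with E v v | E⇒< {v} {v}
  ... | false | _   = refl
  ... | true  | v<v = ⊥-elim (<-irrefl refl (v<v tt))

  graph : Graph n
  graph = record
    { adj    = λ x y → Adj (toℕ x) (toℕ y)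
    ; sym    = λ x y → ∨-comm (E (toℕ x) (toℕ y)) (E (toℕ y) (toℕ x))
    ; irrefl = λ x → cong₂ _∨_ (E-irrefl (toℕ x)) (E-irrefl (toℕ x))
    }

  Adj-oriented : ∀ u v → (u <ᵇ v) ∧ Adj u v ≡ E u v
  Adj-oriented u v with E u v | E⇒< {u} {v} | E v u | E⇒< {v} {u}
  ... | true  | u<v | _     | _   = trans (∧-identityʳ _) (dec-true (u <? v) (u<v tt))
  ... | false | _   | true  | v<u = cong (_∧ true) (dec-false (u <? v) (<⇒≯ (v<u tt)))
  ... | false | _   | false | _   = ∧-zeroʳ (u <ᵇ v)

  edgeCount-graph : edgeCount graph ≡ ∑[ u < n ] ∑[ v < n ] b2n (E u v)
  edgeCount-graph = begin
    edgeCount graph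
      ≡⟨ sum-concatMap _ (allFin n) ⟩
    sum (map (λ x → sum (map (λ y → b2n ((toℕ x <ᵇ toℕ y) ∧ Adj (toℕ x) (toℕ y))) (allFin n))) (allFin n))
      ≡⟨ cong sum (map-cong (λ x → sum-allFin n (λ v → b2n ((toℕ x <ᵇ v) ∧ Adj (toℕ x) v))) (allFin n)) ⟩
    sum (map (λ x → ∑[ v < n ] b2n ((toℕ x <ᵇ v) ∧ Adj (toℕ x) v)) (allFin n))
      ≡⟨ sum-allFin n _ ⟩
    ∑[ u < n ] ∑[ v < n ] b2n ((u <ᵇ v) ∧ Adj u v)
      ≡⟨ ∑-cong n (λ u _ → ∑-cong n (λ v _ → cong b2n (Adj-oriented u v))) ⟩
    ∑[ u < n ] ∑[ v < n ] b2n (E u v) ∎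
    where open ≡-Reasoning

  degSum-graph : ∀ P → degSum graph (subsetᴺ n P) ≡ ∑[ x < n ] (if P x then ∑[ u < n ] b2n (Adj x u) else 0)
  degSum-graph P = trans (cong sum (map-cong pointwise (allFin n))) (sum-allFin n _)
    where
    pointwise : ∀ x → (if lookup (subsetᴺ n P) x then deg graph x else 0)
                      ≡ (if P (toℕ x) then ∑[ u < n ] b2n (Adj (toℕ x) u) else 0)
    pointwise x = cong₂ (λ b d → if b then d else 0)
                        (lookup∘tabulate (P ∘ toℕ) x) (sum-allFin n (λ u → b2n (Adj (toℕ x) u)))

  Dominatesᴺ : (ℕ → Bool) → Set
  Dominatesᴺ s = ∀ v → v < n → T (s v) ⊎ ∃ λ u → u < n × T (s u) × T (Adj u v)

  Dominating⇒Dominatesᴺ : ∀ {S} → Dominating graph S → Dominatesᴺ (χ S)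
  Dominating⇒Dominatesᴺ {S} dom v v<n with dom (fromℕ< v<n)
  ... | inj₁ x∈S             = inj₁ (subst (T ∘ χ S) (toℕ-fromℕ< v<n) (∈⇒χ x∈S))
  ... | inj₂ (u , u∈S , adj) = inj₂ (toℕ u , toℕ<n u , ∈⇒χ u∈S ,
    subst (λ w → T (Adj (toℕ u) w)) (toℕ-fromℕ< v<n) (Equivalence.from T-≡ adj))

  Dominatesᴺ⇒Dominating : ∀ P → Dominatesᴺ P → Dominating graph (subsetᴺ n P)
  Dominatesᴺ⇒Dominating P dom x with dom (toℕ x) (toℕ<n x)
  ... | inj₁ Px                   = inj₁ (χ⇒∈ (subst T (sym (χ-subsetᴺ P (toℕ<n x))) Px))
  ... | inj₂ (u , u<n , Pu , adj) = inj₂ (fromℕ< u<n ,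
    χ⇒∈ (subst T (sym (trans (cong (χ (subsetᴺ n P)) (toℕ-fromℕ< u<n)) (χ-subsetᴺ P u<n))) Pu) ,
    Equivalence.to T-≡ (subst (λ w → T (Adj w (toℕ x))) (sym (toℕ-fromℕ< u<n)) adj))

  noIsolated-graph : (∀ v → v < n → ∃ λ u → u < n × T (Adj v u)) → NoIsolated graph
  noIsolated-graph neighbour x with neighbour (toℕ x) (toℕ<n x)
  ... | u , u<n , adj = fromℕ< u<n ,
    Equivalence.to T-≡ (subst (λ w → T (Adj (toℕ x) w)) (sym (toℕ-fromℕ< u<n)) adj)

  bipartite-graph : (colour : ℕ → Bool) → (∀ {u v} → T (E u v) → colour u ≢ colour v) → Bipartite graph
  bipartite-graph colour proper = colour ∘ toℕ , λ x y adj → properAdj (Equivalence.to T-∨ (Equivalence.from T-≡ adj))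
    where
    properAdj : ∀ {u v} → T (E u v) ⊎ T (E v u) → colour u ≢ colour v
    properAdj (inj₁ uv) = proper uv
    properAdj (inj₂ vu) = proper vu ∘ sym

-- Vertex layout: D = [0, g) splits into P = [0, c) and Q = [c, g); [g, H) holds one leaf d + f for
-- each d ∈ Q; [H, K) are the X P-hubs, [K, Z) the Y Q-hubs, and [Z, n) further pendant vertices.
-- Every v ∉ D has exactly one neighbour in D, owner v: the P-hubs H + k and H + (c + k) belong to
-- k ∈ P (further P-hubs to 0), the Q-hub K + j to c + j ∈ Q (further Q-hubs and [Z, n) to c).
-- The remaining edges join every P-hub to every Q-hub, except the δ pairs (H + i, K) with i < δ.
module ExtremalGraph (c f X Y δ n : ℕ) (1≤c : 1 ≤ c) (1≤f : 1 ≤ f) (2c≤X : c + c ≤ X) (f≤Y : f ≤ Y)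
                     (δ≤X : δ ≤ X) (Z≤n : c + f + f + X + Y ≤ n) where

  g H K Z : ℕ
  g = c + f
  H = g + f
  K = H + X
  Z = K + Y

  c≤g : c ≤ g
  c≤g = m≤m+n c f

  g≤H : g ≤ H
  g≤H = m≤m+n g f

  H≤K : H ≤ K
  H≤K = m≤m+n H X

  g≤K : g ≤ K
  g≤K = ≤-trans g≤H H≤K

  K<Z : K < Z
  K<Z = m<m+n K (≤-trans 1≤f f≤Y)

  K≤n : K ≤ n
  K≤n = ≤-trans (<⇒≤ K<Z) Z≤n

  g≤n : g ≤ n
  g≤n = ≤-trans g≤K K≤n

  PHub QHub : ℕ → Set
  PHub v = H ≤ v × v < K
  QHub v = K ≤ v × v < Z

  PHub? : ∀ v → Dec (PHub v)
  PHub? v = (H ≤? v) ×-dec (v <? K)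

  QHub? : ∀ v → Dec (QHub v)
  QHub? v = (K ≤? v) ×-dec (v <? Z)

  PHub-at : ∀ {i} → i < X → PHub (H + i)
  PHub-at {i} i<X = m≤m+n H i , +-monoʳ-< H i<X

  QHub-at : ∀ {j} → j < Y → QHub (K + j)
  QHub-at {j} j<Y = m≤m+n K j , +-monoʳ-< K j<Y

  PHub⇒g≤ : ∀ {v} → PHub v → g ≤ v
  PHub⇒g≤ (H≤v , _) = ≤-trans g≤H H≤v

  QHub⇒g≤ : ∀ {v} → QHub v → g ≤ v
  QHub⇒g≤ (K≤v , _) = ≤-trans g≤K K≤v

  PHub⇒<n : ∀ {v} → PHub v → v < n
  PHub⇒<n (_ , v<K) = <-≤-trans v<K K≤n

  QHub⇒<n : ∀ {v} → QHub v → v < n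
  QHub⇒<n (_ , v<Z) = <-≤-trans v<Z Z≤n

  QHub⇒¬PHub : ∀ {v} → QHub v → ¬ PHub v
  QHub⇒¬PHub (K≤v , _) (_ , v<K) = <⇒≱ v<K K≤v

  first-PHub<X : ∀ {k} → k < c → k < X
  first-PHub<X k<c = <-≤-trans k<c (≤-trans (m≤m+n c c) 2c≤X)

  second-PHub<X : ∀ {k} → k < c → c + k < X
  second-PHub<X k<c = <-≤-trans (+-monoʳ-< c k<c) 2c≤X

  pHubOwner : ℕ → ℕ
  pHubOwner i = if i <ᵇ c then i else if i <ᵇ c + c then i ∸ c else 0

  owner : ℕ → ℕ
  owner v = if v <ᵇ H then v ∸ f else if v <ᵇ K then pHubOwner (v ∸ H) else if v <ᵇ K + f then c + (v ∸ K) else c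

  pHubOwner<c : ∀ i → pHubOwner i < c
  pHubOwner<c i with i <ᵇ c | <ᵇ-reflects-< i c
  ... | true  | ofʸ i<c = i<c
  ... | false | ofⁿ i≮c with i <ᵇ c + c | <ᵇ-reflects-< i (c + c)
  ...   | true  | ofʸ i<2c = +-cancelˡ-< c _ _ (subst (_< c + c) (sym (m+[n∸m]≡n (≮⇒≥ i≮c))) i<2c)
  ...   | false | _        = 1≤c

  owner-leaf : ∀ {d} → d < g → owner (d + f) ≡ d
  owner-leaf {d} d<g rewrite dec-true (d + f <? H) (+-monoˡ-< f d<g) = m+n∸n≡m d f

  owner-PHub-at : ∀ {i} → i < X → owner (H + i) ≡ pHubOwner i
  owner-PHub-at {i} i<X
    rewrite dec-false (H + i <? H) (m+n≮m H i) | dec-true (H + i <? K) (+-monoʳ-< H i<X) | m+n∸m≡n H i = refl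

  owner-first-PHub : ∀ {k} → k < c → owner (H + k) ≡ k
  owner-first-PHub {k} k<c rewrite owner-PHub-at (first-PHub<X k<c) | dec-true (k <? c) k<c = refl

  owner-second-PHub : ∀ {k} → k < c → owner (H + (c + k)) ≡ k
  owner-second-PHub {k} k<c
    rewrite owner-PHub-at (second-PHub<X k<c)
          | dec-false (c + k <? c) (m+n≮m c k) | dec-true (c + k <? c + c) (+-monoʳ-< c k<c) | m+n∸m≡n c k = refl

  owner-QHub-at : ∀ {j} → j < f → owner (K + j) ≡ c + j
  owner-QHub-at {j} j<f
    rewrite dec-false (K + j <? H) (≤⇒≯ (≤-trans H≤K (m≤m+n K j))) | dec-false (K + j <? K) (m+n≮m K j)
          | dec-true (K + j <? K + f) (+-monoʳ-< K j<f) | m+n∸m≡n K j = refl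

  owner-PHub : ∀ {v} → PHub v → owner v < c
  owner-PHub {v} (H≤v , v<K) rewrite dec-false (v <? H) (≤⇒≯ H≤v) | dec-true (v <? K) v<K = pHubOwner<c (v ∸ H)

  owner-non-PHub : ∀ {v} → g ≤ v → ¬ PHub v → c ≤ owner v × owner v < g
  owner-non-PHub {v} g≤v ¬ph with v <ᵇ H | <ᵇ-reflects-< v H
  ... | true  | ofʸ v<H = subst (_≤ v ∸ f) (m+n∸n≡m c f) (∸-monoˡ-≤ f g≤v)
                        , subst (v ∸ f <_) (m+n∸n≡m g f) (∸-monoˡ-< v<H (≤-trans (m≤n+m f c) g≤v))
  ... | false | ofⁿ v≮H with v <ᵇ K | <ᵇ-reflects-< v K
  ...   | true  | ofʸ v<K = ⊥-elim (¬ph (≮⇒≥ v≮H , v<K))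
  ...   | false | ofⁿ v≮K with v <ᵇ K + f | <ᵇ-reflects-< v (K + f)
  ...     | true  | ofʸ v<K+f = m≤m+n c _ , +-monoʳ-< c (subst (v ∸ K <_) (m+n∸m≡n K f) (∸-monoˡ-< v<K+f (≮⇒≥ v≮K)))
  ...     | false | _         = ≤-refl , m<m+n c 1≤f

  owner<g : ∀ {v} → g ≤ v → owner v < g
  owner<g {v} g≤v with PHub? v
  ... | yes ph  = <-≤-trans (owner-PHub ph) c≤g
  ... | no  ¬ph = proj₂ (owner-non-PHub g≤v ¬ph)

  Owns HubPair : ℕ → ℕ → Set
  Owns u v    = g ≤ v × owner v ≡ u
  HubPair u v = PHub u × QHub v

  Owns? : ∀ u v → Dec (Owns u v)
  Owns? u v = (g ≤? v) ×-dec (owner v ≟ u)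

  Owns⇒D : ∀ {u v} → Owns u v → u < g
  Owns⇒D (g≤v , refl) = owner<g g≤v

  owns removed hubEdge E : ℕ → ℕ → Bool
  owns u v    = does (Owns? u v)
  removed u v = ((H ≤ᵇ u) ∧ (u <ᵇ H + δ)) ∧ (K ≡ᵇ v)
  hubEdge u v = does (PHub? u ×-dec QHub? v) ∧ not (removed u v)
  E u v       = owns u v ∨ hubEdge u v

  hubEdge⇒ : ∀ {u v} → T (hubEdge u v) → HubPair u v
  hubEdge⇒ {u} {v} h = does⇒ (PHub? u ×-dec QHub? v) (proj₁ (Equivalence.to T-∧ h))

  E⇒ : ∀ {u v} → T (E u v) → Owns u v ⊎ HubPair u v
  E⇒ {u} {v} e with Equivalence.to T-∨ e
  ... | inj₁ o = inj₁ (does⇒ (Owns? u v) o)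
  ... | inj₂ h = inj₂ (hubEdge⇒ h)

  E⇒< : ∀ {u v} → T (E u v) → u < v
  E⇒< e with E⇒ e
  ... | inj₁ (g≤v , refl)              = <-≤-trans (owner<g g≤v) g≤v
  ... | inj₂ ((_ , u<K) , (K≤v , _))   = <-≤-trans u<K K≤v

  open OrientedGraph n E E⇒< public

  Adj⇒ : ∀ {u v} → T (Adj u v) → Owns u v ⊎ Owns v u ⊎ HubPair u v ⊎ HubPair v u
  Adj⇒ a with Equivalence.to T-∨ a
  ... | inj₁ uv with E⇒ uv
  ...   | inj₁ o = inj₁ o
  ...   | inj₂ h = inj₂ (inj₂ (inj₁ h))
  Adj⇒ a | inj₂ vu with E⇒ vu
  ...   | inj₁ o = inj₂ (inj₁ o)
  ...   | inj₂ h = inj₂ (inj₂ (inj₂ h))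

  Adj-owner : ∀ {v} → g ≤ v → T (Adj (owner v) v) × T (Adj v (owner v))
  Adj-owner {v} g≤v = Equivalence.from T-∨ (inj₁ owner-edge)
                    , Equivalence.from (T-∨ {E v (owner v)}) (inj₂ owner-edge)
    where
    owner-edge : T (E (owner v) v)
    owner-edge = Equivalence.from T-∨ (inj₁ (does⇐ (Owns? (owner v) v) (g≤v , refl)))

  neighbours-of-D : ∀ {u d} → d < g → T (Adj u d) → Owns d u
  neighbours-of-D d<g a with Adj⇒ a
  ... | inj₁ (g≤d , _)             = ⊥-elim (<⇒≱ d<g g≤d)
  ... | inj₂ (inj₁ o)              = o
  ... | inj₂ (inj₂ (inj₁ (_ , qd))) = ⊥-elim (<⇒≱ d<g (QHub⇒g≤ qd))
  ... | inj₂ (inj₂ (inj₂ (pd , _))) = ⊥-elim (<⇒≱ d<g (PHub⇒g≤ pd))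

  neighbours-of-leaf : ∀ {u d} → c ≤ d → d < g → T (Adj u (d + f)) → u ≡ d
  neighbours-of-leaf c≤d d<g a with Adj⇒ a
  ... | inj₁ (_ , refl)                       = owner-leaf d<g
  ... | inj₂ (inj₁ (g≤u , owned))             = ⊥-elim (<⇒≱ (subst (_< g) owned (owner<g g≤u)) (+-monoˡ-≤ f c≤d))
  ... | inj₂ (inj₂ (inj₁ (_ , (K≤l , _))))    = ⊥-elim (<⇒≱ (+-monoˡ-< f d<g) (≤-trans H≤K K≤l))
  ... | inj₂ (inj₂ (inj₂ ((H≤l , _) , _)))    = ⊥-elim (<⇒≱ (+-monoˡ-< f d<g) H≤l)

  neighbours-of-PHub : ∀ {u h} → PHub h → T (Adj u h) → u ≡ owner h ⊎ QHub u
  neighbours-of-PHub ph a with Adj⇒ a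
  ... | inj₁ (_ , owned)             = inj₁ (sym owned)
  ... | inj₂ (inj₁ (g≤u , owned))    = ⊥-elim (<⇒≱ (subst (_< g) owned (owner<g g≤u)) (PHub⇒g≤ ph))
  ... | inj₂ (inj₂ (inj₁ (_ , qh)))  = ⊥-elim (QHub⇒¬PHub qh ph)
  ... | inj₂ (inj₂ (inj₂ (_ , qu)))  = inj₂ qu

  neighbours-of-QHub : ∀ {u q} → QHub q → T (Adj u q) → u ≡ owner q ⊎ PHub u
  neighbours-of-QHub qq a with Adj⇒ a
  ... | inj₁ (_ , owned)             = inj₁ (sym owned)
  ... | inj₂ (inj₁ (g≤u , owned))    = ⊥-elim (<⇒≱ (subst (_< g) owned (owner<g g≤u)) (QHub⇒g≤ qq))
  ... | inj₂ (inj₂ (inj₁ (pu , _)))  = inj₂ pu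
  ... | inj₂ (inj₂ (inj₂ (pq , _)))  = ⊥-elim (QHub⇒¬PHub qq pq)

  every-vertex-has-neighbour : ∀ v → v < n → ∃ λ u → u < n × T (Adj v u)
  every-vertex-has-neighbour v _ with v <? c | v <? g
  ... | yes v<c | _       = H + v , PHub⇒<n ph ,
                            subst (λ w → T (Adj w (H + v))) (owner-first-PHub v<c) (proj₁ (Adj-owner (PHub⇒g≤ ph)))
    where ph = PHub-at (first-PHub<X v<c)
  ... | no  v≮c | yes v<g = v + f , <-≤-trans (+-monoˡ-< f v<g) (≤-trans H≤K K≤n) ,
                            subst (λ w → T (Adj w (v + f))) (owner-leaf v<g) (proj₁ (Adj-owner (+-monoˡ-≤ f (≮⇒≥ v≮c))))
  ... | no  _   | no  v≮g = owner v , <-≤-trans (owner<g (≮⇒≥ v≮g)) g≤n , proj₂ (Adj-owner (≮⇒≥ v≮g))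

  -- A vertex outside D takes the colour opposite to that of its owner.
  colour : ℕ → Bool
  colour v = if v <ᵇ g then c ≤ᵇ v else owner v <ᵇ c

  colour-proper : ∀ {u v} → T (E u v) → colour u ≢ colour v
  colour-proper {u} {v} e with E⇒ e
  ... | inj₁ (g≤v , refl)
    rewrite dec-true (owner v <? g) (owner<g g≤v) | dec-false (v <? g) (≤⇒≯ g≤v) = opposite (owner v)
    where
    opposite : ∀ w → (c ≤ᵇ w) ≢ (w <ᵇ c)
    opposite w with w <? c
    ... | yes w<c rewrite dec-true (w <? c) w<c | dec-false (c ≤? w) (<⇒≱ w<c) = λ ()
    ... | no  w≮c rewrite dec-false (w <? c) w≮c | dec-true (c ≤? w) (≮⇒≥ w≮c) = λ ()
  ... | inj₂ (pu , qv)
    rewrite dec-false (u <? g) (≤⇒≯ (PHub⇒g≤ pu)) | dec-false (v <? g) (≤⇒≯ (QHub⇒g≤ qv))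
          | dec-true (owner u <? c) (owner-PHub pu)
          | dec-false (owner v <? c) (≤⇒≯ (proj₁ (owner-non-PHub (QHub⇒g≤ qv) (QHub⇒¬PHub qv))))
    = λ ()

  rep : ℕ → ℕ
  rep v = if v <ᵇ g then v else owner v

  rep-D : ∀ {d} → d < g → rep d ≡ d
  rep-D {d} d<g rewrite dec-true (d <? g) d<g = refl

  rep-non-D : ∀ {v} → g ≤ v → rep v ≡ owner v
  rep-non-D {v} g≤v rewrite dec-false (v <? g) (≤⇒≯ g≤v) = refl

  rep<g : ∀ v → rep v < g
  rep<g v with v <? g
  ... | yes v<g = subst (_< g) (sym (rep-D v<g)) v<g
  ... | no  v≮g = subst (_< g) (sym (rep-non-D (≮⇒≥ v≮g))) (owner<g (≮⇒≥ v≮g))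

  module Dominated (s : ℕ → Bool) (dom : Dominatesᴺ s) where

    covers : ∀ d → d < g → ∃ λ v → v < n × T (s v) × rep v ≡ d
    covers d d<g with dom d (<-≤-trans d<g g≤n)
    ... | inj₁ sd = d , <-≤-trans d<g g≤n , sd , rep-D d<g
    ... | inj₂ (u , u<n , su , a) with neighbours-of-D d<g a
    ...   | g≤u , owned = u , u<n , su , trans (rep-non-D g≤u) owned

    open Pigeonhole {N = n} s rep (λ v _ → rep<g v) covers public

    module Tight (tight : ∑[ v < n ] b2n (s v) ≡ g) where

      same-rep : ∀ {x y} → x < n → y < n → T (s x) → T (s y) → rep x ≡ rep y → x ≡ y
      same-rep = tight⇒rep-injective tight

      owner-in⇒not-in : ∀ {v} → g ≤ v → v < n → T (s (owner v)) → ¬ T (s v)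
      owner-in⇒not-in {v} g≤v v<n so sv =
        <⇒≢ (<-≤-trans (owner<g g≤v) g≤v)
            (same-rep (<-≤-trans (owner<g g≤v) g≤n) v<n so sv (trans (rep-D (owner<g g≤v)) (sym (rep-non-D g≤v))))

      Q-class-below-H : ∀ {d} → c ≤ d → d < g → ∃ λ y → y < H × T (s y) × rep y ≡ d
      Q-class-below-H {d} c≤d d<g with dom (d + f) (<-≤-trans (+-monoˡ-< f d<g) (≤-trans H≤K K≤n))
      ... | inj₁ sl = d + f , +-monoˡ-< f d<g , sl , trans (rep-non-D (+-monoˡ-≤ f c≤d)) (owner-leaf d<g)
      ... | inj₂ (u , _ , su , a) =
        d , <-≤-trans d<g g≤H , subst (T ∘ s) (neighbours-of-leaf c≤d d<g a) su , rep-D d<g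

      QHub-not-in : ∀ {q} → QHub q → ¬ T (s q)
      QHub-not-in qq@(K≤q , _) sq with owner-non-PHub (QHub⇒g≤ qq) (QHub⇒¬PHub qq)
      ... | c≤o , o<g with Q-class-below-H c≤o o<g
      ...   | y , y<H , sy , ry =
        <⇒≢ (<-≤-trans y<H (≤-trans H≤K K≤q))
            (same-rep (<-≤-trans y<H (≤-trans H≤K K≤n)) (QHub⇒<n qq) sy sq (trans ry (sym (rep-non-D (QHub⇒g≤ qq)))))

      owner-out⇒PHub-in : ∀ {h} → PHub h → ¬ T (s (owner h)) → T (s h)
      owner-out⇒PHub-in {h} ph ¬so with dom h (PHub⇒<n ph)
      ... | inj₁ sh = sh
      ... | inj₂ (u , _ , su , a) with neighbours-of-PHub ph a
      ...   | inj₁ refl = ⊥-elim (¬so su)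
      ...   | inj₂ qu   = ⊥-elim (QHub-not-in qu su)

      P-vertex-in : ∀ {k} → k < c → T (s k)
      P-vertex-in {k} k<c with T? (s k)
      ... | yes sk  = sk
      ... | no  ¬sk = ⊥-elim (<⇒≢ (m<n+m k 1≤c) (+-cancelˡ-≡ H k (c + k)
                        (same-rep (PHub⇒<n ph₁) (PHub⇒<n ph₂) in₁ in₂ same-owner)))
        where
        ph₁ = PHub-at (first-PHub<X k<c)
        ph₂ = PHub-at (second-PHub<X k<c)
        in₁ = owner-out⇒PHub-in ph₁ (¬sk ∘ subst (T ∘ s) (owner-first-PHub k<c))
        in₂ = owner-out⇒PHub-in ph₂ (¬sk ∘ subst (T ∘ s) (owner-second-PHub k<c))
        same-owner : rep (H + k) ≡ rep (H + (c + k))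
        same-owner = begin
          rep (H + k)          ≡⟨ rep-non-D (PHub⇒g≤ ph₁) ⟩
          owner (H + k)        ≡⟨ owner-first-PHub k<c ⟩
          k                    ≡⟨ owner-second-PHub k<c ⟨
          owner (H + (c + k))  ≡⟨ rep-non-D (PHub⇒g≤ ph₂) ⟨
          rep (H + (c + k))    ∎
          where open ≡-Reasoning

      PHub-not-in : ∀ {h} → PHub h → ¬ T (s h)
      PHub-not-in ph = owner-in⇒not-in (PHub⇒g≤ ph) (PHub⇒<n ph) (P-vertex-in (owner-PHub ph))

      QHub⇒owner-in : ∀ {q} → QHub q → T (s (owner q))
      QHub⇒owner-in {q} qq with dom q (QHub⇒<n qq)
      ... | inj₁ sq = ⊥-elim (QHub-not-in qq sq)
      ... | inj₂ (u , _ , su , a) with neighbours-of-QHub qq a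
      ...   | inj₁ refl = su
      ...   | inj₂ pu   = ⊥-elim (PHub-not-in pu su)

      Q-vertex-in : ∀ {j} → j < f → T (s (c + j))
      Q-vertex-in j<f = subst (T ∘ s) (owner-QHub-at j<f) (QHub⇒owner-in (QHub-at (<-≤-trans j<f f≤Y)))

      D-in : ∀ {d} → d < g → T (s d)
      D-in {d} d<g with d <? c
      ... | yes d<c = P-vertex-in d<c
      ... | no  d≮c = subst (T ∘ s) d≡c+j (Q-vertex-in (+-cancelˡ-< c _ _ (subst (_< c + f) (sym d≡c+j) d<g)))
        where d≡c+j = m+[n∸m]≡n (≮⇒≥ d≮c)

      s≗D : ∀ v → v < n → s v ≡ (v <ᵇ g)
      s≗D v v<n with v <? g
      ... | yes v<g = trans (dec-true (T? (s v)) (D-in v<g)) (sym (dec-true (v <? g) v<g))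
      ... | no  v≮g = trans (dec-false (T? (s v)) (owner-in⇒not-in g≤v v<n (D-in (owner<g g≤v)))) (sym (dec-false (v <? g) v≮g))
        where g≤v = ≮⇒≥ v≮g

  no-E-into-D : ∀ {u x} → x < g → ¬ T (E u x)
  no-E-into-D x<g e with E⇒ e
  ... | inj₁ (g≤x , _) = <⇒≱ x<g g≤x
  ... | inj₂ (_ , qx)  = <⇒≱ x<g (QHub⇒g≤ qx)

  Adj-from-D : ∀ {x} → x < g → ∀ u → Adj x u ≡ owns x u
  Adj-from-D {x} x<g u
    rewrite dec-false (T? (hubEdge x u)) (λ h → <⇒≱ x<g (PHub⇒g≤ (proj₁ (hubEdge⇒ h))))
          | dec-false (T? (E u x)) (no-E-into-D x<g)
    = trans (∨-identityʳ _) (∨-identityʳ (owns x u))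

  ∑owns : ∑[ u < n ] ∑[ v < n ] b2n (owns u v) ≡ n ∸ g
  ∑owns = begin
    ∑[ u < n ] ∑[ v < n ] b2n (owns u v)  ≡⟨ ∑-comm (λ u v → b2n (owns u v)) n n ⟩
    ∑[ v < n ] ∑[ u < n ] b2n (owns u v)  ≡⟨ ∑-cong n (λ v _ → ∑-indicator (g ≤ᵇ v) (owner v) n (owner<n v)) ⟩
    ∑[ v < n ] b2n (g ≤ᵇ v)               ≡⟨ count-≥ g n g≤n ⟩
    n ∸ g                                 ∎
    where
    open ≡-Reasoning
    owner<n : ∀ v → T (g ≤ᵇ v) → owner v < n
    owner<n v g≤v = <-≤-trans (owner<g (≤ᵇ⇒≤ g v g≤v)) g≤n

  degSum-D : degSum graph (subsetᴺ n (_<ᵇ g)) ≡ n ∸ g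
  degSum-D = trans (degSum-graph (_<ᵇ g)) (trans (∑-cong n (λ x _ → degree x)) ∑owns)
    where
    degree : ∀ x → (if x <ᵇ g then ∑[ u < n ] b2n (Adj x u) else 0) ≡ ∑[ u < n ] b2n (owns x u)
    degree x with x <? g
    ... | yes x<g rewrite dec-true (x <? g) x<g = ∑-cong n (λ u _ → cong b2n (Adj-from-D x<g u))
    ... | no  x≮g rewrite dec-false (x <? g) x≮g =
      sym (∑-zero n (λ u _ → cong b2n (dec-false (T? (owns x u)) (x≮g ∘ Owns⇒D ∘ does⇒ (Owns? x u)))))

  removed⇒HubPair : ∀ {u v} → T (removed u v) → HubPair u v
  removed⇒HubPair {u} {v} r with Equivalence.to T-∧ r
  ... | range , K≡v with Equivalence.to T-∧ range
  ...   | H≤u , u<H+δ = (≤ᵇ⇒≤ H u H≤u , <-≤-trans (<ᵇ⇒< u (H + δ) u<H+δ) (+-monoʳ-≤ H δ≤X))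
                      , subst QHub (≡ᵇ⇒≡ K v K≡v) (≤-refl , K<Z)

  ∑removed : ∑[ u < n ] ∑[ v < n ] b2n (removed u v) ≡ δ
  ∑removed = begin
    ∑[ u < n ] ∑[ v < n ] b2n (removed u v)
      ≡⟨ count-pairs (λ u → (H ≤ᵇ u) ∧ (u <ᵇ H + δ)) (K ≡ᵇ_) n n ⟩
    ∑[ u < n ] b2n ((H ≤ᵇ u) ∧ (u <ᵇ H + δ)) * ∑[ v < n ] b2n (K ≡ᵇ v)
      ≡⟨ cong₂ _*_ (count-range H (H + δ) n (m≤m+n H δ) (≤-trans (+-monoʳ-≤ H δ≤X) K≤n))
                   (count-≡ K n (<-≤-trans K<Z Z≤n)) ⟩
    (H + δ ∸ H) * 1
      ≡⟨ trans (*-identityʳ _) (m+n∸m≡n H δ) ⟩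
    δ ∎
    where open ≡-Reasoning

  ∑hubEdge+δ : ∑[ u < n ] ∑[ v < n ] b2n (hubEdge u v) + δ ≡ X * Y
  ∑hubEdge+δ = begin
    ∑[ u < n ] ∑[ v < n ] b2n (hubEdge u v) + δ
      ≡⟨ cong (∑[ u < n ] ∑[ v < n ] b2n (hubEdge u v) +_) ∑removed ⟨
    ∑[ u < n ] ∑[ v < n ] b2n (hubEdge u v) + ∑[ u < n ] ∑[ v < n ] b2n (removed u v)
      ≡⟨ ∑₂-distrib-+ (λ u v → b2n (hubEdge u v)) (λ u v → b2n (removed u v)) n n ⟨
    ∑[ u < n ] ∑[ v < n ] (b2n (hubEdge u v) + b2n (removed u v))
      ≡⟨ ∑-cong n (λ u _ → ∑-cong n (λ v _ → b2n-∧-not (does⇐ (PHub? u ×-dec QHub? v) ∘ removed⇒HubPair))) ⟩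
    ∑[ u < n ] ∑[ v < n ] b2n (does (PHub? u) ∧ does (QHub? v))
      ≡⟨ count-pairs (does ∘ PHub?) (does ∘ QHub?) n n ⟩
    ∑[ u < n ] b2n (does (PHub? u)) * ∑[ v < n ] b2n (does (QHub? v))
      ≡⟨ cong₂ _*_ (count-range H K n H≤K K≤n) (count-range K Z n (<⇒≤ K<Z) Z≤n) ⟩
    (K ∸ H) * (Z ∸ K)
      ≡⟨ cong₂ _*_ (m+n∸m≡n H X) (m+n∸m≡n K Y) ⟩
    X * Y ∎
    where open ≡-Reasoning

  edgeCount+δ : edgeCount graph + δ ≡ (n ∸ g) + X * Y
  edgeCount+δ = begin
    edgeCount graph + δ
      ≡⟨ cong (_+ δ) edgeCount-graph ⟩
    ∑[ u < n ] ∑[ v < n ] b2n (E u v) + δ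
      ≡⟨ cong (_+ δ) (∑-cong n (λ u _ → ∑-cong n (λ v _ → b2n-∨-disjoint owns-not-hubEdge))) ⟩
    ∑[ u < n ] ∑[ v < n ] (b2n (owns u v) + b2n (hubEdge u v)) + δ
      ≡⟨ cong (_+ δ) (∑₂-distrib-+ (λ u v → b2n (owns u v)) (λ u v → b2n (hubEdge u v)) n n) ⟩
    ∑[ u < n ] ∑[ v < n ] b2n (owns u v) + ∑[ u < n ] ∑[ v < n ] b2n (hubEdge u v) + δ
      ≡⟨ +-assoc (∑[ u < n ] ∑[ v < n ] b2n (owns u v)) _ δ ⟩
    ∑[ u < n ] ∑[ v < n ] b2n (owns u v) + (∑[ u < n ] ∑[ v < n ] b2n (hubEdge u v) + δ)
      ≡⟨ cong₂ _+_ ∑owns ∑hubEdge+δ ⟩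
    (n ∸ g) + X * Y ∎
    where
    open ≡-Reasoning
    owns-not-hubEdge : ∀ {u v} → T (owns u v) → ¬ T (hubEdge u v)
    owns-not-hubEdge {u} {v} o h = <⇒≱ (Owns⇒D (does⇒ (Owns? u v) o)) (PHub⇒g≤ (proj₁ (hubEdge⇒ h)))

  D : Subset n
  D = subsetᴺ n (_<ᵇ g)

  D-dominating : Dominating graph D
  D-dominating = Dominatesᴺ⇒Dominating (_<ᵇ g) dominated
    where
    dominated : Dominatesᴺ (_<ᵇ g)
    dominated v v<n with v <? g
    ... | yes v<g = inj₁ (<⇒<ᵇ v<g)
    ... | no  v≮g = inj₂ (owner v , <-≤-trans o<g g≤n , <⇒<ᵇ o<g , proj₁ (Adj-owner (≮⇒≥ v≮g)))
      where o<g = owner<g (≮⇒≥ v≮g)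

  ∣D∣ : ∣ D ∣ ≡ g
  ∣D∣ = trans (∣subsetᴺ∣ n (_<ᵇ g)) (count-< g n g≤n)

  g≤∣dominating∣ : ∀ S → Dominating graph S → g ≤ ∣ S ∣
  g≤∣dominating∣ S dom = subst (g ≤_) (sym (∣∣≡∑χ S)) (Dominated.g≤∣s∣ (χ S) (Dominating⇒Dominatesᴺ dom))

  minimum-dominating-unique : ∀ S → Dominating graph S → ∣ S ∣ ≡ g → S ≡ D
  minimum-dominating-unique S dom ∣S∣≡g = subsetᴺ-unique S (_<ᵇ g)
    (Dominated.Tight.s≗D (χ S) (Dominating⇒Dominatesᴺ dom) (trans (sym (∣∣≡∑χ S)) ∣S∣≡g))

  in-B : InB graph g
  in-B = bipartite-graph colour colour-proper
       , noIsolated-graph every-vertex-has-neighbour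
       , ((D , D-dominating , ∣D∣) , g≤∣dominating∣)
       , (D , (D-dominating , ∣D∣) , λ S (dom , ∣S∣≡g) → minimum-dominating-unique S dom ∣S∣≡g)

  perfectly-dominated : PerfectlyDominated graph g
  perfectly-dominated = D , (D-dominating , ∣D∣) , degSum-D

-- Choice of the parameters

⌈n/2⌉+⌊n/2⌋≡n : ∀ n → ⌈ n /2⌉ + ⌊ n /2⌋ ≡ n
⌈n/2⌉+⌊n/2⌋≡n n = trans (+-comm ⌈ n /2⌉ ⌊ n /2⌋) (⌊n/2⌋+⌈n/2⌉≡n n)

m∸[m∸n]≤n : ∀ m n → m ∸ (m ∸ n) ≤ n
m∸[m∸n]≤n m n = m≤n+o⇒m∸n≤o m (m ∸ n) (subst (m ≤_) (+-comm n (m ∸ n)) (m≤n+m∸n m n))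

sumTerm-closed : ∀ A p → sumTerm A p ≡ p * A + ⌈ p /2⌉ * suc ⌊ p /2⌋
sumTerm-closed A zero    = refl
sumTerm-closed A (suc p) = begin
  sumTerm A p + (A + suc ⌊ p /2⌋)                    ≡⟨ cong (_+ (A + suc ⌊ p /2⌋)) (sumTerm-closed A p) ⟩
  p * A + ⌈ p /2⌉ * suc ⌊ p /2⌋ + (A + suc ⌊ p /2⌋)  ≡⟨ step p A ⌈ p /2⌉ ⌊ p /2⌋ ⟩
  suc p * A + suc ⌊ p /2⌋ * suc ⌈ p /2⌉              ∎
  where
  open ≡-Reasoning
  step : ∀ p A u d → p * A + u * suc d + (A + suc d) ≡ suc p * A + suc d * suc u
  step = solve-∀

overflow-past-cap : ∀ c k a e → suc k + a ≡ 2 * c + 1 → (a + e + 1) ∸ (2 * c + suc k) ≡ e ∸ (k + k)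
overflow-past-cap c k a e f+a≡2c+1 = begin
  (a + e + 1) ∸ (2 * c + suc k)      ≡⟨ cong₂ _∸_ (shift a e) 2c+f≡a+suc[2k] ⟩
  (a + suc e) ∸ (a + suc (k + k))    ≡⟨ [m+n]∸[m+o]≡n∸o a (suc e) (suc (k + k)) ⟩
  e ∸ (k + k)                        ∎
  where
  open ≡-Reasoning
  shift : ∀ x y → x + y + 1 ≡ x + suc y
  shift = solve-∀
  carry : ∀ x y → x + suc y ≡ x + 1 + y
  carry = solve-∀
  regroup : ∀ x y → suc y + x + y ≡ x + suc (y + y)
  regroup = solve-∀
  2c+f≡a+suc[2k] : 2 * c + suc k ≡ a + suc (k + k)
  2c+f≡a+suc[2k] = begin
    2 * c + suc k    ≡⟨ carry (2 * c) k ⟩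
    2 * c + 1 + k    ≡⟨ cong (_+ k) f+a≡2c+1 ⟨
    suc k + a + k    ≡⟨ regroup a k ⟩
    a + suc (k + k)  ∎

dimension-bounds : ∀ c f m → 1 ≤ f → f ≤ c →
  let M = m ⊓ ((2 * c + 1) ∸ f) ; Φ = (m + 1) ∸ (2 * c + f) in
  ∃ λ r → m ≡ M + Φ + r × r ≤ c + c × (Φ ≡ 0 ⊎ f + M ≡ 2 * c + 1)
dimension-bounds c (suc k) m _ f≤c with m ≤? (2 * c + 1) ∸ suc k
... | yes m≤a = 0 , sym M+Φ+0≡m , z≤n , inj₁ Φ≡0
  where
  M = m ⊓ ((2 * c + 1) ∸ suc k)
  Φ = (m + 1) ∸ (2 * c + suc k)
  m+1≤2c+f : m + 1 ≤ 2 * c + suc k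
  m+1≤2c+f = begin
    m + 1                     ≤⟨ +-monoˡ-≤ 1 m≤a ⟩
    (2 * c + 1) ∸ suc k + 1   ≤⟨ +-monoˡ-≤ 1 (∸-monoʳ-≤ (2 * c + 1) (s≤s z≤n)) ⟩
    (2 * c + 1) ∸ 1 + 1       ≡⟨ m∸n+n≡m (m≤n+m 1 (2 * c)) ⟩
    2 * c + 1                 ≤⟨ +-monoʳ-≤ (2 * c) (s≤s z≤n) ⟩
    2 * c + suc k             ∎
    where open ≤-Reasoning
  Φ≡0 : Φ ≡ 0
  Φ≡0 = m≤n⇒m∸n≡0 m+1≤2c+f
  M+Φ+0≡m : M + Φ + 0 ≡ m
  M+Φ+0≡m = trans (cong₂ (λ x y → x + y + 0) (m≤n⇒m⊓n≡m m≤a) Φ≡0) (trans (+-identityʳ (m + 0)) (+-identityʳ m))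
... | no m≰a = e ∸ Φ , m≡M+Φ+r , r≤2c , inj₂ (trans (cong (suc k +_) M≡a) f+a≡2c+1)
  where
  a = (2 * c + 1) ∸ suc k
  e = m ∸ a
  M = m ⊓ a
  Φ = (m + 1) ∸ (2 * c + suc k)
  a≤m : a ≤ m
  a≤m = <⇒≤ (≰⇒> m≰a)
  M≡a : M ≡ a
  M≡a = m≥n⇒m⊓n≡n a≤m
  f+a≡2c+1 : suc k + a ≡ 2 * c + 1
  f+a≡2c+1 = m+[n∸m]≡n (≤-trans f≤c (≤-trans (m≤m+n c (c + 0)) (m≤m+n (2 * c) 1)))
  Φ≡e∸2k : Φ ≡ e ∸ (k + k)
  Φ≡e∸2k = trans (cong (λ x → (x + 1) ∸ (2 * c + suc k)) (sym (m+[n∸m]≡n a≤m))) (overflow-past-cap c k a e f+a≡2c+1)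
  m≡M+Φ+r : m ≡ M + Φ + (e ∸ Φ)
  m≡M+Φ+r = begin
    m                  ≡⟨ m+[n∸m]≡n a≤m ⟨
    a + e              ≡⟨ cong (a +_) (m+[n∸m]≡n (subst (_≤ e) (sym Φ≡e∸2k) (m∸n≤m e (k + k)))) ⟨
    a + (Φ + (e ∸ Φ))  ≡⟨ +-assoc a Φ (e ∸ Φ) ⟨
    a + Φ + (e ∸ Φ)    ≡⟨ cong (λ x → x + Φ + (e ∸ Φ)) M≡a ⟨
    M + Φ + (e ∸ Φ)    ∎
    where open ≡-Reasoning
  r≤2c : e ∸ Φ ≤ c + c
  r≤2c = subst (λ x → e ∸ x ≤ c + c) (sym Φ≡e∸2k)
               (≤-trans (m∸[m∸n]≤n e (k + k)) (+-mono-≤ (<⇒≤ f≤c) (<⇒≤ f≤c)))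

balance-identity : ∀ g c f M u d r → u * (2 * c + 1) ≡ u * (f + M) →
  2 * g + 2 * c * f + M * (2 * c + 1) + ((d + u) * (2 * c + 1) + u * suc d) + r
    ≡ 2 * g + (M + (d + u) + r) + (c + c + u) * (f + M + d)
balance-identity g c f M u d r saturated = begin
  2 * g + 2 * c * f + M * (2 * c + 1) + ((d + u) * (2 * c + 1) + u * suc d) + r  ≡⟨ isolate g c f M u d r ⟩
  rest + u * (2 * c + 1)                                                        ≡⟨ cong (rest +_) saturated ⟩
  rest + u * (f + M)                                                            ≡⟨ collect g c f M u d r ⟩
  2 * g + (M + (d + u) + r) + (c + c + u) * (f + M + d)                         ∎
  where
  open ≡-Reasoning
  rest = 2 * g + 2 * c * f + M * (2 * c + 1) + d * (2 * c + 1) + u * suc d + r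
  isolate : ∀ g c f M u d r →
    2 * g + 2 * c * f + M * (2 * c + 1) + ((d + u) * (2 * c + 1) + u * suc d) + r
      ≡ 2 * g + 2 * c * f + M * (2 * c + 1) + d * (2 * c + 1) + u * suc d + r + u * (2 * c + 1)
  isolate = solve-∀
  collect : ∀ g c f M u d r →
    2 * g + 2 * c * f + M * (2 * c + 1) + d * (2 * c + 1) + u * suc d + r + u * (f + M)
      ≡ 2 * g + (M + (d + u) + r) + (c + c + u) * (f + M + d)
  collect = solve-∀

record Dimensions (g n : ℕ) : Set where
  field
    X Y δ   : ℕ
    2c≤X    : ⌈ g /2⌉ + ⌈ g /2⌉ ≤ X
    f≤Y     : ⌊ g /2⌋ ≤ Y
    δ≤X     : δ ≤ X
    fits    : ⌈ g /2⌉ + ⌊ g /2⌋ + ⌊ g /2⌋ + X + Y ≤ n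
    balance : edgeFormula n g + δ ≡ (n ∸ g) + X * Y

-- Of the m = n - 3g vertices beyond D, f leaves, 2c P-hubs and f Q-hubs, the first M become further
-- Q-hubs, the next Φ are shared between P- and Q-hubs, and the last r are pendant vertices at c,
-- each paid for by one removed hub edge.
dimensions : ∀ g n → 2 ≤ g → 3 * g ≤ n → Dimensions g n
dimensions g n 2≤g 3g≤n with dimension-bounds ⌈ g /2⌉ ⌊ g /2⌋ (n ∸ 3 * g) (⌊n/2⌋-mono 2≤g) (⌊n/2⌋≤⌈n/2⌉ g)
... | r , m≡M+Φ+r , r≤2c , saturation = record
  { X       = c + c + u
  ; Y       = f + M + d
  ; δ       = r
  ; 2c≤X    = m≤m+n (c + c) u
  ; f≤Y     = ≤-trans (m≤m+n f M) (m≤m+n (f + M) d)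
  ; δ≤X     = ≤-trans r≤2c (m≤m+n (c + c) u)
  ; fits    = ≤-trans (m≤m+n _ r) (≤-reflexive size)
  ; balance = balance
  }
  where
  open ≡-Reasoning
  c = ⌈ g /2⌉
  f = ⌊ g /2⌋
  m = n ∸ 3 * g
  M = m ⊓ ((2 * c + 1) ∸ f)
  Φ = (m + 1) ∸ (2 * c + f)
  u = ⌈ Φ /2⌉
  d = ⌊ Φ /2⌋
  n≡3g+m : n ≡ 3 * g + m
  n≡3g+m = sym (m+[n∸m]≡n 3g≤n)
  m≡M+[d+u]+r : m ≡ M + (d + u) + r
  m≡M+[d+u]+r = trans m≡M+Φ+r (cong (λ x → M + x + r) (sym (⌊n/2⌋+⌈n/2⌉≡n Φ)))
  size : c + f + f + (c + c + u) + (f + M + d) + r ≡ n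
  size = begin
    c + f + f + (c + c + u) + (f + M + d) + r  ≡⟨ regroup c f M u d r ⟩
    3 * (c + f) + (M + (d + u) + r)            ≡⟨ cong₂ (λ x y → 3 * x + y) (⌈n/2⌉+⌊n/2⌋≡n g) (sym m≡M+[d+u]+r) ⟩
    3 * g + m                                  ≡⟨ n≡3g+m ⟨
    n                                          ∎
    where
    regroup : ∀ c f M u d r → c + f + f + (c + c + u) + (f + M + d) + r ≡ 3 * (c + f) + (M + (d + u) + r)
    regroup = solve-∀
  n∸g : n ∸ g ≡ 2 * g + (M + (d + u) + r)
  n∸g = begin
    n ∸ g                    ≡⟨ cong (_∸ g) (trans n≡3g+m (split g m)) ⟩
    g + (2 * g + m) ∸ g      ≡⟨ m+n∸m≡n g (2 * g + m) ⟩
    2 * g + m                ≡⟨ cong (2 * g +_) m≡M+[d+u]+r ⟩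
    2 * g + (M + (d + u) + r) ∎
    where
    split : ∀ g m → 3 * g + m ≡ g + (2 * g + m)
    split = solve-∀
  sumTerm-Φ : sumTerm (2 * c + 1) ((n + 1) ∸ (3 * g + 2 * c + f)) ≡ (d + u) * (2 * c + 1) + u * suc d
  sumTerm-Φ = begin
    sumTerm (2 * c + 1) ((n + 1) ∸ (3 * g + 2 * c + f))
      ≡⟨ cong (λ x → sumTerm (2 * c + 1) ((x + 1) ∸ (3 * g + 2 * c + f))) n≡3g+m ⟩
    sumTerm (2 * c + 1) ((3 * g + m + 1) ∸ (3 * g + 2 * c + f))
      ≡⟨ cong (sumTerm (2 * c + 1)) (cong₂ _∸_ (+-assoc (3 * g) m 1) (+-assoc (3 * g) (2 * c) f)) ⟩
    sumTerm (2 * c + 1) ((3 * g + (m + 1)) ∸ (3 * g + (2 * c + f)))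
      ≡⟨ cong (sumTerm (2 * c + 1)) ([m+n]∸[m+o]≡n∸o (3 * g) (m + 1) (2 * c + f)) ⟩
    sumTerm (2 * c + 1) Φ
      ≡⟨ sumTerm-closed (2 * c + 1) Φ ⟩
    Φ * (2 * c + 1) + u * suc d
      ≡⟨ cong (λ x → x * (2 * c + 1) + u * suc d) (⌊n/2⌋+⌈n/2⌉≡n Φ) ⟨
    (d + u) * (2 * c + 1) + u * suc d ∎
  saturated : u * (2 * c + 1) ≡ u * (f + M)
  saturated = [ (λ Φ≡0 → trans (cong (λ x → ⌈ x /2⌉ * (2 * c + 1)) Φ≡0)
                                (cong (λ x → ⌈ x /2⌉ * (f + M)) (sym Φ≡0)))
              , (λ f+M≡2c+1 → cong (u *_) (sym f+M≡2c+1))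
              ]′ saturation
  balance : edgeFormula n g + r ≡ (n ∸ g) + (c + c + u) * (f + M + d)
  balance = begin
    edgeFormula n g + r
      ≡⟨ cong (λ x → 2 * g + 2 * c * f + M * (2 * c + 1) + x + r) sumTerm-Φ ⟩
    2 * g + 2 * c * f + M * (2 * c + 1) + ((d + u) * (2 * c + 1) + u * suc d) + r
      ≡⟨ balance-identity g c f M u d r saturated ⟩
    2 * g + (M + (d + u) + r) + (c + c + u) * (f + M + d)
      ≡⟨ cong (_+ (c + c + u) * (f + M + d)) n∸g ⟨
    (n ∸ g) + (c + c + u) * (f + M + d) ∎

corollary2p6 : (g n : ℕ) → 2 ≤ g → 3 * g ≤ n →
    Σ (Graph n) λ G → InB G g × PerfectlyDominated G g × edgeCount G ≡ edgeFormula n g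
corollary2p6 g n 2≤g 3g≤n =
  graph , subst (InB graph) c+f≡g in-B , subst (PerfectlyDominated graph) c+f≡g perfectly-dominated , edges
  where
  open Dimensions (dimensions g n 2≤g 3g≤n)
  1≤f = ⌊n/2⌋-mono 2≤g
  open ExtremalGraph ⌈ g /2⌉ ⌊ g /2⌋ X Y δ n (≤-trans 1≤f (⌊n/2⌋≤⌈n/2⌉ g)) 1≤f 2c≤X f≤Y δ≤X fits
    using (graph; in-B; perfectly-dominated; edgeCount+δ)
  c+f≡g = ⌈n/2⌉+⌊n/2⌋≡n g
  edges : edgeCount graph ≡ edgeFormula n g
  edges = +-cancelʳ-≡ δ _ _ (trans edgeCount+δ (trans (cong (λ h → (n ∸ h) + X * Y) c+f≡g) (sym balance)))
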